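{- Let $G$ be a graph of order $n$ with $\delta(G)\geq 2\sqrt{n}$. Then $\mathrm{cut}(G)+\mathrm{compo}(G)-1\leq 2\sqrt{n}$.
   Context: All graphs are finite and simple; $G$ need not be connected. $\delta(G)$ is the minimum degree of $G$. $\mathrm{compo}(G)$ is the number of connected components of $G$. A vertex $u$ of $G$ is a cut-vertex if $\mathrm{compo}(G-u)>\mathrm{compo}(G)$ (this definition applies also to disconnected graphs), and $\mathrm{cut}(G)$ is the number of cut-vertices of $G$. -}

module Defs where

open import Data.Nat using (ℕ; zero; suc; _+_; _<ᵇ_)
open import Data.Bool using (Bool; true; false; _∧_; _∨_; not; if_then_else_)
open import Data.Fin using (Fin; toℕ; _≟_)
open import Relation.Nullary.Decidable using (⌊_⌋)
open import Relation.Binary.PropositionalEquality using (_≡_)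

record Graph (n : ℕ) : Set where
  field
    adj    : Fin n → Fin n → Bool
    sym    : ∀ u v → adj u v ≡ adj v u
    irrefl : ∀ v → adj v v ≡ false
open Graph public

count : {n : ℕ} → (Fin n → Bool) → ℕ
count {zero}  p = 0
count {suc n} p = (if p Fin.zero then 1 else 0) + count (λ i → p (Fin.suc i))
  where import Data.Fin as Fin

anyFin : {n : ℕ} → (Fin n → Bool) → Bool
anyFin {zero}  p = false
anyFin {suc n} p = p Fin.zero ∨ anyFin (λ i → p (Fin.suc i))
  where import Data.Fin as Fin

degree : {n : ℕ} → Graph n → Fin n → ℕ
degree G v = count (adj G v)

-- Vertex subsets (used for induced subgraphs G[S], e.g. G - u).
VSet : ℕ → Set
VSet n = Fin n → Bool

allV : {n : ℕ} → VSet n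
allV _ = true

minusV : {n : ℕ} → VSet n → Fin n → VSet n
minusV S u v = S v ∧ not ⌊ v ≟ u ⌋

reach : {n : ℕ} → Graph n → VSet n → ℕ → Fin n → Fin n → Bool
reach G S zero    u v = S u ∧ S v ∧ ⌊ u ≟ v ⌋
reach G S (suc k) u v =
  reach G S k u v ∨ anyFin (λ w → reach G S k u w ∧ adj G w v ∧ S v)

-- u and v lie in the same connected component of G[S]
-- (walks of length ≤ n suffice in a graph on n vertices)
connected : {n : ℕ} → Graph n → VSet n → Fin n → Fin n → Bool
connected {n} G S = reach G S n

-- number of connected components of G[S]: each component is counted
-- once, via its vertex of least index
compoOn : {n : ℕ} → Graph n → VSet n → ℕ
compoOn G S = count (λ v → S v ∧ not (anyFin (λ u → (toℕ u <ᵇ toℕ v) ∧ connected G S u v)))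

compo : {n : ℕ} → Graph n → ℕ
compo G = compoOn G allV

isCut : {n : ℕ} → Graph n → Fin n → Bool
isCut G u = compo G <ᵇ compoOn G (minusV allV u)

cut : {n : ℕ} → Graph n → ℕ
cut G = count (isCut G)

{-# OPTIONS --safe #-}
-- Root each component at its vertex of least index, and say that x is below u when x ≠ u
-- and every walk from x to that root passes through u. Vertices below cut vertices form
-- a tree-like (laminar) family mirroring the block-cut tree. For u with something below
-- it, induction on the number of vertices below u gives
--   δ · (1 + #cut vertices below u) + #neighbours of u below u ≤ 2 · #vertices below u:
-- the vertices below u split into the children (topmost cut vertices below u), the
-- vertices below a child, and the remaining loose ones, and the minimum degree of a loose
-- vertex or of a child forces δ ≤ #loose + #children + Σ_child #neighbours below the child.
-- At a root this reads δ · (#cut vertices in the component + 1) ≤ 2 · #component, so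
-- summing over components δ · (cut G + compo G) ≤ 2n, and δ² ≥ 4n gives (cut G + compo G)² ≤ n.
module Submission where

open import Algebra.Bundles using (CommutativeMonoid)
import Algebra.Properties.CommutativeSemigroup as CommutativeSemigroupProperties
open import Data.Bool using (Bool; true; false; _∧_; _∨_; not; if_then_else_; T)
open import Data.Bool.Properties using (T-∧; T-∨; ∧-commutativeMonoid)
open import Data.Empty using (⊥; ⊥-elim)
open import Data.Fin using (Fin; zero; suc; toℕ; _≟_)
open import Data.Fin.Properties using (toℕ-injective; any?)
open import Data.Nat
  using (ℕ; zero; suc; _+_; _*_; _∸_; _≤_; _<_; _≤?_; z≤n; s≤s; _<ᵇ_; _≤′_; ≤′-refl; ≤′-step; NonZero)
open import Data.Nat.Induction using (<-wellFounded)
open import Data.Nat.Properties hiding (_≟_)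
open import Data.Nat.Solver using (module +-*-Solver)
open import Data.Product using (∃-syntax; _×_; _,_; proj₁; proj₂)
open import Data.Sum using (_⊎_; inj₁; inj₂; [_,_]′)
open import Data.Unit using (⊤; tt)
open import Defs hiding (sym)
open import Function using (_∘_; id; _⇔_; mk⇔; Equivalence)
open import Induction.WellFounded using (WellFounded; Acc; acc)
import Relation.Binary.Construct.On as On
open import Relation.Binary.PropositionalEquality
open import Relation.Nullary using (¬_; Dec; yes; no; contradiction; ¬?; _×-dec_)
open import Relation.Nullary.Decidable
  using (⌊_⌋; T?; toWitness; fromWitness; toWitnessFalse; fromWitnessFalse; map′)
open import Relation.Unary using (Pred; Decidable)
open import Algebra.Properties.Semiring.Sum +-*-semiring
  using (sum; sum-syntax; ∑-distrib-+; ∑-comm; sum-cong-≗; *-distribˡ-sum)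
open +-*-Solver using (solve; _:+_; _:*_; _:=_; con)

module ∧-Props = CommutativeSemigroupProperties (CommutativeMonoid.commutativeSemigroup ∧-commutativeMonoid)
module *-Props = CommutativeSemigroupProperties *-commutativeSemigroup

T-not⇒¬T : ∀ {b} → T (not b) → ¬ T b
T-not⇒¬T {false} _ ()

¬T⇒T-not : ∀ {b} → ¬ T b → T (not b)
¬T⇒T-not {false} _  = _
¬T⇒T-not {true}  ¬b = ¬b _

𝟙 : Bool → ℕ
𝟙 b = if b then 1 else 0

𝟙-true : ∀ {b} → T b → 𝟙 b ≡ 1
𝟙-true {true} _ = refl

𝟙-false : ∀ {b} → ¬ T b → 𝟙 b ≡ 0
𝟙-false {false} _  = refl
𝟙-false {true}  ¬b = ⊥-elim (¬b _)

𝟙≤1 : ∀ b → 𝟙 b ≤ 1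
𝟙≤1 false = z≤n
𝟙≤1 true  = ≤-refl

𝟙-mono : ∀ {b c} → (T b → T c) → 𝟙 b ≤ 𝟙 c
𝟙-mono {false}         _   = z≤n
𝟙-mono {true}  {true}  _   = ≤-refl
𝟙-mono {true}  {false} b⇒c = ⊥-elim (b⇒c _)

𝟙-∧ : ∀ b c → 𝟙 (b ∧ c) ≡ 𝟙 b * 𝟙 c
𝟙-∧ false c = refl
𝟙-∧ true  c = sym (+-identityʳ (𝟙 c))

𝟙-∨ : ∀ b c → 𝟙 (b ∨ c) ≤ 𝟙 b + 𝟙 c
𝟙-∨ false c = ≤-refl
𝟙-∨ true  c = s≤s z≤n

𝟙-∨-disjoint : ∀ {b c} → (T b → ¬ T c) → 𝟙 (b ∨ c) ≡ 𝟙 b + 𝟙 c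
𝟙-∨-disjoint {false}         _    = refl
𝟙-∨-disjoint {true}  {false} _    = refl
𝟙-∨-disjoint {true}  {true}  b⇒¬c = ⊥-elim (b⇒¬c _ _)

𝟙*-mono : ∀ b {x y} → (T b → x ≤ y) → 𝟙 b * x ≤ 𝟙 b * y
𝟙*-mono false _   = z≤n
𝟙*-mono true  x≤y = +-monoˡ-≤ 0 (x≤y _)

∑-mono-≤ : ∀ {n} {f g : Fin n → ℕ} → (∀ i → f i ≤ g i) → sum f ≤ sum g
∑-mono-≤ {zero}  f≤g = z≤n
∑-mono-≤ {suc n} f≤g = +-mono-≤ (f≤g zero) (∑-mono-≤ (f≤g ∘ suc))

term≤∑ : ∀ {n} (f : Fin n → ℕ) (i : Fin n) → f i ≤ sum f
term≤∑ f zero    = m≤m+n (f zero) _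
term≤∑ f (suc i) = ≤-trans (term≤∑ (f ∘ suc) i) (m≤n+m _ (f zero))

count≡∑ : ∀ {n} (p : Fin n → Bool) → count p ≡ ∑[ i < n ] 𝟙 (p i)
count≡∑ {zero}  p = refl
count≡∑ {suc n} p = cong (𝟙 (p zero) +_) (count≡∑ (p ∘ suc))

count-mono : ∀ {n} {p q : Fin n → Bool} → (∀ i → T (p i) → T (q i)) → count p ≤ count q
count-mono {p = p} {q} p⊆q =
  subst₂ _≤_ (sym (count≡∑ p)) (sym (count≡∑ q)) (∑-mono-≤ (λ i → 𝟙-mono (p⊆q i)))

count-∨ : ∀ {n} (p q : Fin n → Bool) → count (λ i → p i ∨ q i) ≤ count p + count q
count-∨ p q = begin
  count (λ i → p i ∨ q i)                 ≡⟨ count≡∑ (λ i → p i ∨ q i) ⟩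
  ∑[ i < _ ] 𝟙 (p i ∨ q i)                ≤⟨ ∑-mono-≤ (λ i → 𝟙-∨ (p i) (q i)) ⟩
  ∑[ i < _ ] (𝟙 (p i) + 𝟙 (q i))          ≡⟨ ∑-distrib-+ (𝟙 ∘ p) (𝟙 ∘ q) ⟩
  ∑[ i < _ ] 𝟙 (p i) + ∑[ i < _ ] 𝟙 (q i) ≡⟨ sym (cong₂ _+_ (count≡∑ p) (count≡∑ q)) ⟩
  count p + count q                       ∎
  where open ≤-Reasoning

count-∨-disjoint : ∀ {n} {p q : Fin n → Bool} → (∀ i → T (p i) → ¬ T (q i)) →
                   count (λ i → p i ∨ q i) ≡ count p + count q
count-∨-disjoint {p = p} {q} disjoint = begin
  count (λ i → p i ∨ q i)                 ≡⟨ count≡∑ (λ i → p i ∨ q i) ⟩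
  ∑[ i < _ ] 𝟙 (p i ∨ q i)                ≡⟨ sum-cong-≗ (λ i → 𝟙-∨-disjoint (disjoint i)) ⟩
  ∑[ i < _ ] (𝟙 (p i) + 𝟙 (q i))          ≡⟨ ∑-distrib-+ (𝟙 ∘ p) (𝟙 ∘ q) ⟩
  ∑[ i < _ ] 𝟙 (p i) + ∑[ i < _ ] 𝟙 (q i) ≡⟨ sym (cong₂ _+_ (count≡∑ p) (count≡∑ q)) ⟩
  count p + count q                       ∎
  where open ≡-Reasoning

count≤n : ∀ {n} (p : Fin n → Bool) → count p ≤ n
count≤n {zero}  p = z≤n
count≤n {suc n} p = +-mono-≤ (𝟙≤1 (p zero)) (count≤n (p ∘ suc))

count-none : ∀ {n} {p : Fin n → Bool} → (∀ i → ¬ T (p i)) → count p ≡ 0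
count-none {zero}  _    = refl
count-none {suc n} none = cong₂ _+_ (𝟙-false (none zero)) (count-none (none ∘ suc))

count-cong : ∀ {n} {p q : Fin n → Bool} → (∀ i → p i ≡ q i) → count p ≡ count q
count-cong {zero}  _   = refl
count-cong {suc n} p≗q = cong₂ _+_ (cong 𝟙 (p≗q zero)) (count-cong (p≗q ∘ suc))

count-true : ∀ {n} → count {n} (λ _ → true) ≡ n
count-true {zero}  = refl
count-true {suc n} = cong suc (count-true {n})

count-singleton : ∀ {n} (j : Fin n) → count (λ i → ⌊ i ≟ j ⌋) ≡ 1
count-singleton {suc n} zero    = cong suc (count-none {n} {λ _ → false} λ _ ())
count-singleton {suc n} (suc j) = trans (count-cong λ i → ⌊suc≟suc⌋ i) (count-singleton j)
  where
  -- Not definitional: ⌊_⌋ is stuck on the map′ in the suc case of Fin's _≟_.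
  ⌊suc≟suc⌋ : ∀ i → ⌊ suc i ≟ suc j ⌋ ≡ ⌊ i ≟ j ⌋
  ⌊suc≟suc⌋ i with i ≟ j
  ... | yes _ = refl
  ... | no  _ = refl

count-< : ∀ {n} {p q : Fin n → Bool} {j : Fin n} →
          (∀ i → T (p i) → T (q i)) → T (q j) → ¬ T (p j) → count p < count q
count-< {p = p} {q} {j} p⊆q qj ¬pj = begin-strict
  count p                               <⟨ m<m+n (count p) (s≤s z≤n) ⟩
  count p + 1                           ≡⟨ cong (count p +_) (sym (count-singleton j)) ⟩
  count p + count (λ i → ⌊ i ≟ j ⌋)     ≡⟨ sym (count-∨-disjoint p∌j) ⟩
  count (λ i → p i ∨ ⌊ i ≟ j ⌋)         ≤⟨ count-mono p∪j⊆q ⟩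
  count q                               ∎
  where
  open ≤-Reasoning
  p∌j : ∀ i → T (p i) → ¬ T ⌊ i ≟ j ⌋
  p∌j i pi i≡j = ¬pj (subst (T ∘ p) (toWitness i≡j) pi)
  p∪j⊆q : ∀ i → T (p i ∨ ⌊ i ≟ j ⌋) → T (q i)
  p∪j⊆q i h with Equivalence.to T-∨ h
  ... | inj₁ pi  = p⊆q i pi
  ... | inj₂ i≡j = subst (T ∘ q) (sym (toWitness i≡j)) qj

count>0 : ∀ {n} {p : Fin n → Bool} {j : Fin n} → T (p j) → 0 < count p
count>0 {p = p} {j} pj = subst (_≤ count p) (count-singleton j)
  (count-mono {p = λ i → ⌊ i ≟ j ⌋} λ i i≡j → subst (T ∘ p) (sym (toWitness i≡j)) pj)

count>0⇒∃ : ∀ {n} {p : Fin n → Bool} → 0 < count p → ∃[ i ] T (p i)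
count>0⇒∃ {p = p} count>0 with any? (T? ∘ p)
... | yes found = found
... | no  none  = contradiction (count-none λ i pi → none (i , pi)) (≢-sym (<⇒≢ count>0))

count≤1 : ∀ {n} {p : Fin n → Bool} → (∀ i j → T (p i) → T (p j) → i ≡ j) → count p ≤ 1
count≤1 {p = p} unique with any? (T? ∘ p)
... | yes (j , pj) = subst (count p ≤_) (count-singleton j)
                      (count-mono {q = λ i → ⌊ i ≟ j ⌋} λ i pi → fromWitness (unique i j pi pj))
... | no  none      = ≤-trans (≤-reflexive (count-none λ i pi → none (i , pi))) z≤n

𝟙*count : ∀ {n} (b : Bool) (p : Fin n → Bool) → 𝟙 b * count p ≡ count (λ i → b ∧ p i)
𝟙*count {n} false p = sym (count-none {n} {λ _ → false} λ _ ())
𝟙*count     true  p = +-identityʳ (count p)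

∑-count-comm : ∀ {m n} (P : Fin m → Fin n → Bool) →
               ∑[ i < m ] count (P i) ≡ ∑[ j < n ] count (λ i → P i j)
∑-count-comm P = begin
  ∑[ i < _ ] count (P i)                 ≡⟨ sum-cong-≗ (λ i → count≡∑ (P i)) ⟩
  ∑[ i < _ ] ∑[ j < _ ] 𝟙 (P i j)         ≡⟨ ∑-comm (λ i j → 𝟙 (P i j)) ⟩
  ∑[ j < _ ] ∑[ i < _ ] 𝟙 (P i j)         ≡⟨ sum-cong-≗ (λ j → sym (count≡∑ (λ i → P i j))) ⟩
  ∑[ j < _ ] count (λ i → P i j)         ∎
  where open ≡-Reasoning

T-anyFin : ∀ {n} {p : Fin n → Bool} → T (anyFin p) ⇔ (∃[ i ] T (p i))
T-anyFin {zero}          = mk⇔ (λ ()) (λ ())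
T-anyFin {suc n} {p = p} = mk⇔ to from
  where
  to : T (anyFin p) → ∃[ i ] T (p i)
  to h with Equivalence.to (T-∨ {p zero}) h
  ... | inj₁ p0 = zero , p0
  ... | inj₂ ps with Equivalence.to T-anyFin ps
  ...   | i , pi = suc i , pi
  from : ∃[ i ] T (p i) → T (anyFin p)
  from (zero  , p0) = Equivalence.from (T-∨ {p zero}) (inj₁ p0)
  from (suc i , pi) = Equivalence.from (T-∨ {p zero}) (inj₂ (Equivalence.from T-anyFin (i , pi)))

min-witness : ∀ {m p} {P : Pred (Fin m) p} → Decidable P → (f : Fin m → ℕ) → ∀ {x} → P x →
              ∃[ j ] P j × (∀ k → P k → f j ≤ f k)
min-witness {suc m} P? f {x} Px with any? (P? ∘ suc)
... | no none with x
...   | zero   = zero , Px , λ where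
        zero    _  → ≤-refl
        (suc k) Pk → contradiction (k , Pk) none
...   | suc x′ = contradiction (x′ , Px) none
min-witness {suc m} P? f Px | yes (_ , Px′) with min-witness (P? ∘ suc) (f ∘ suc) Px′
... | j , Pj , least with P? zero
...   | no ¬P0 = suc j , Pj , λ where
        zero    P0 → contradiction P0 ¬P0
        (suc k) Pk → least k Pk
...   | yes P0 with f zero ≤? f (suc j)
...     | yes f0≤fj = zero , P0 , λ where
          zero    _  → ≤-refl
          (suc k) Pk → ≤-trans f0≤fj (least k Pk)
...     | no  f0≰fj = suc j , Pj , λ where
          zero    _  → <⇒≤ (≰⇒> f0≰fj)
          (suc k) Pk → least k Pk

minusV-∋ : ∀ {n} {S : VSet n} {u z : Fin n} → T (S z) → z ≢ u → T (minusV S u z)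
minusV-∋ {S = S} {z = z} s z≢u = Equivalence.from (T-∧ {S z}) (s , fromWitnessFalse z≢u)

minusV-⊆ : ∀ {n} {S : VSet n} {u z : Fin n} → T (minusV S u z) → T (S z)
minusV-⊆ {S = S} {z = z} h = proj₁ (Equivalence.to (T-∧ {S z}) h)

minusV-∌ : ∀ {n} {S : VSet n} {u z : Fin n} → T (minusV S u z) → z ≢ u
minusV-∌ {S = S} {z = z} h = toWitnessFalse (proj₂ (Equivalence.to (T-∧ {S z}) h))

module _ {n : ℕ} (G : Graph n) where

  adj-sym : ∀ {x y} → T (adj G x y) → T (adj G y x)
  adj-sym {x} {y} = subst T (Graph.sym G x y)

  adj⇒≢ : ∀ {x y} → T (adj G x y) → x ≢ y
  adj⇒≢ {x} xy refl = subst T (irrefl G x) xy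

  data Walk (S : VSet n) (x : Fin n) : Fin n → Set where
    here : T (S x) → Walk S x x
    step : ∀ {y z} → Walk S x y → T (adj G y z) → T (S z) → Walk S x z

  walk-source : ∀ {S x y} → Walk S x y → T (S x)
  walk-source (here s)     = s
  walk-source (step w _ _) = walk-source w

  walk-target : ∀ {S x y} → Walk S x y → T (S y)
  walk-target (here s)     = s
  walk-target (step _ _ s) = s

  walk-mono : ∀ {S S′ x y} → (∀ z → T (S z) → T (S′ z)) → Walk S x y → Walk S′ x y
  walk-mono S⊆S′ (here s)      = here (S⊆S′ _ s)
  walk-mono S⊆S′ (step w yz s) = step (walk-mono S⊆S′ w) yz (S⊆S′ _ s)

  walk-trans : ∀ {S x y z} → Walk S x y → Walk S y z → Walk S x z
  walk-trans w (here _)      = w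
  walk-trans w (step v yz s) = step (walk-trans w v) yz s

  walk-cons : ∀ {S x y z} → T (adj G x y) → T (S x) → Walk S y z → Walk S x z
  walk-cons xy sx (here sy)     = step (here sx) xy sy
  walk-cons xy sx (step w yz s) = step (walk-cons xy sx w) yz s

  walk-sym : ∀ {S x y} → Walk S x y → Walk S y x
  walk-sym (here s)      = here s
  walk-sym (step w yz s) = walk-cons (adj-sym yz) s (walk-sym w)

  edge : ∀ {S x y} → T (adj G x y) → T (S x) → T (S y) → Walk S x y
  edge xy sx sy = step (here sx) xy sy

  reach-zero : ∀ {S x} → T (S x) → T (reach G S zero x x)
  reach-zero {S} {x} sx = Equivalence.from (T-∧ {S x}) (sx , Equivalence.from (T-∧ {S x}) (sx , fromWitness refl))

  reach-suc : ∀ {S} k {x y} → T (reach G S k x y) → T (reach G S (suc k) x y)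
  reach-suc {S} k {x} {y} r = Equivalence.from (T-∨ {reach G S k x y}) (inj₁ r)

  reach-step : ∀ {S} k {x w z} → T (reach G S k x w) → T (adj G w z) → T (S z) →
               T (reach G S (suc k) x z)
  reach-step {S} k {x} {w} {z} xw wz sz =
    Equivalence.from (T-∨ {reach G S k x z})
      (inj₂ (Equivalence.from T-anyFin (w , Equivalence.from (T-∧ {reach G S k x w})
        (xw , Equivalence.from (T-∧ {adj G w z}) (wz , sz)))))

  reach-suc-inv : ∀ {S} k {x z} → T (reach G S (suc k) x z) →
                  T (reach G S k x z) ⊎ ∃[ w ] T (reach G S k x w) × T (adj G w z) × T (S z)
  reach-suc-inv {S} k {x} {z} h with Equivalence.to (T-∨ {reach G S k x z}) h
  ... | inj₁ r = inj₁ r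
  ... | inj₂ r with Equivalence.to T-anyFin r
  ...   | w , h′ with Equivalence.to (T-∧ {reach G S k x w}) h′
  ...     | xw , h″ = inj₂ (w , xw , Equivalence.to (T-∧ {adj G w z}) h″)

  reach-sound : ∀ {S} k {x y} → T (reach G S k x y) → Walk S x y
  reach-sound {S} zero {x} {y} h with Equivalence.to (T-∧ {S x}) h
  ... | sx , h′ = subst (Walk S x) (toWitness (proj₂ (Equivalence.to (T-∧ {S y}) h′))) (here sx)
  reach-sound (suc k) h with reach-suc-inv k h
  ... | inj₁ r                 = reach-sound k r
  ... | inj₂ (w , xw , wy , sy) = step (reach-sound k xw) wy sy

  walk⇒reach : ∀ {S x y} → Walk S x y → ∃[ k ] T (reach G S k x y)
  walk⇒reach {S} (here s)  = zero , reach-zero {S} s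
  walk⇒reach (step w yz s) = let k , r = walk⇒reach w in suc k , reach-step k r yz s

  -- Once two
  -- consecutive balls agree they agree forever, and a strictly growing chain of subsets of
  -- Fin n stops growing by radius n; so the bound n built into connected loses nothing.
  module Ball (S : VSet n) (x : Fin n) where

    ball : ℕ → Fin n → Bool
    ball k = reach G S k x

    Stable : ℕ → Set
    Stable k = ∀ z → T (ball (suc k) z) → T (ball k z)

    ball-mono : ∀ {k m} → k ≤′ m → ∀ z → T (ball k z) → T (ball m z)
    ball-mono ≤′-refl           _ r = r
    ball-mono (≤′-step {m} k≤m) z r = reach-suc {S} m (ball-mono k≤m z r)

    stable-suc : ∀ {k} → Stable k → Stable (suc k)
    stable-suc {k} st z r with reach-suc-inv (suc k) r
    ... | inj₁ r′                 = r′
    ... | inj₂ (w , xw , wz , sz) = reach-step k (st w xw) wz sz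

    stable-≤′ : ∀ {k m} → Stable k → k ≤′ m → Stable m
    stable-≤′ st ≤′-refl           = st
    stable-≤′ st (≤′-step {m} k≤m) = stable-suc {m} (stable-≤′ st k≤m)

    stable-shrink : ∀ {k m} → Stable k → k ≤′ m → ∀ z → T (ball m z) → T (ball k z)
    stable-shrink st ≤′-refl           _ r = r
    stable-shrink st (≤′-step {m} k≤m) z r = stable-shrink st k≤m z (stable-≤′ {m = m} st k≤m z r)

    grows-until-stable : T (S x) → ∀ k → (∃[ i ] i ≤ k × Stable i) ⊎ k < count (ball k)
    grows-until-stable sx zero = inj₂ (count>0 {j = x} (reach-zero {S} sx))
    grows-until-stable sx (suc k) with grows-until-stable sx k
    ... | inj₁ (i , i≤k , st) = inj₁ (i , m≤n⇒m≤1+n i≤k , st)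
    ... | inj₂ k<|ball| with any? (λ z → T? (ball (suc k) z ∧ not (ball k z)))
    ...   | no  none      = inj₁ (k , n≤1+n k , stable)
      where
      stable : Stable k
      stable z r with T? (ball k z)
      ... | yes r′ = r′
      ... | no ¬r′ = ⊥-elim (none (z , Equivalence.from (T-∧ {ball (suc k) z}) (r , ¬T⇒T-not ¬r′)))
    ...   | yes (z , new) with Equivalence.to (T-∧ {ball (suc k) z}) new
    ...     | inner , outer = inj₂ (≤-trans (s≤s k<|ball|)
                (count-< {p = ball k} {ball (suc k)} (λ _ → reach-suc {S} k) inner (T-not⇒¬T outer)))

    stable-by-n : T (S x) → ∃[ i ] i ≤ n × Stable i
    stable-by-n sx with grows-until-stable sx n
    ... | inj₁ found    = found
    ... | inj₂ n<|ball| = contradiction (count≤n (ball n)) (<⇒≱ n<|ball|)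

    ball-within-n : T (S x) → ∀ k z → T (ball k z) → T (ball n z)
    ball-within-n sx k z r =
      let i , i≤n , st = stable-by-n sx in
      ball-mono (≤⇒≤′ i≤n) z
        (stable-shrink st (≤⇒≤′ (≤-trans i≤n (m≤n+m n k))) z
          (ball-mono (≤⇒≤′ (m≤m+n k n)) z r))

  connected⇔walk : ∀ {S x y} → T (connected G S x y) ⇔ Walk S x y
  connected⇔walk {S} {x} {y} = mk⇔ (reach-sound n) λ w →
    let k , r = walk⇒reach w in Ball.ball-within-n S x (walk-source w) k y r

  walk? : ∀ S x y → Dec (Walk S x y)
  walk? S x y = map′ (reach-sound n) (Equivalence.from connected⇔walk) (T? (connected G S x y))

  _~_ : Fin n → Fin n → Set
  x ~ y = Walk allV x y

  private
    least~ : ∀ u → ∃[ r ] r ~ u × (∀ w → w ~ u → toℕ r ≤ toℕ w)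
    least~ u = min-witness (λ w → walk? allV w u) toℕ (here _)

  root : Fin n → Fin n
  root u = proj₁ (least~ u)

  root~ : ∀ u → root u ~ u
  root~ u = proj₁ (proj₂ (least~ u))

  root-least : ∀ {u w} → w ~ u → toℕ (root u) ≤ toℕ w
  root-least {u} {w} = proj₂ (proj₂ (least~ u)) w

  root-cong : ∀ {u v} → u ~ v → root u ≡ root v
  root-cong {u} {v} u~v = toℕ-injective (≤-antisym
    (root-least (walk-trans (root~ v) (walk-sym u~v)))
    (root-least (walk-trans (root~ u) u~v)))

  root-minimal : ∀ {v} → ¬ toℕ (root v) < toℕ v → root v ≡ v
  root-minimal ¬root<v = toℕ-injective (≤-antisym (root-least (here _)) (≮⇒≥ ¬root<v))

  -- Definitionally the predicate counted by compoOn G S.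
  isRootOnᵇ : VSet n → Fin n → Bool
  isRootOnᵇ S v = S v ∧ not (anyFin (λ u → (toℕ u <ᵇ toℕ v) ∧ connected G S u v))

  isRootOnᵇ-least : ∀ {S u v} → T (isRootOnᵇ S v) → toℕ u < toℕ v → ¬ Walk S u v
  isRootOnᵇ-least {S} {u} {v} h u<v u⟶v = T-not⇒¬T (proj₂ (Equivalence.to (T-∧ {S v}) h))
    (Equivalence.from T-anyFin (u , Equivalence.from (T-∧ {toℕ u <ᵇ toℕ v})
      (<⇒<ᵇ u<v , Equivalence.from connected⇔walk u⟶v)))

  isRootᵇ : Fin n → Bool
  isRootᵇ = isRootOnᵇ allV

  T-isRootᵇ : ∀ {v} → T (isRootᵇ v) ⇔ root v ≡ v
  T-isRootᵇ {v} = mk⇔ (λ h → root-minimal λ root<v → isRootOnᵇ-least h root<v (root~ v)) from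
    where
    from : root v ≡ v → T (isRootᵇ v)
    from root≡v = ¬T⇒T-not λ h →
      let u , h′    = Equivalence.to (T-anyFin {p = λ u → (toℕ u <ᵇ toℕ v) ∧ connected G allV u v}) h
          u<v , u~v = Equivalence.to (T-∧ {toℕ u <ᵇ toℕ v}) h′
      in <⇒≱ (<ᵇ⇒< (toℕ u) (toℕ v) u<v)
           (subst (λ r → toℕ r ≤ toℕ u) root≡v (root-least (Equivalence.to connected⇔walk u~v)))

  allBut : Fin n → VSet n
  allBut u = minusV allV u

  allBut-∋ : ∀ {u z} → z ≢ u → T (allBut u z)
  allBut-∋ z≢u = minusV-∋ {S = allV} _ z≢u

  data LastVisit (S : VSet n) (u a b : Fin n) : Set where
    avoids  : Walk (minusV S u) a b → LastVisit S u a b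
    ends-at : b ≡ u → LastVisit S u a b
    leaves  : ∀ {y} → T (adj G u y) → Walk (minusV S u) y b → LastVisit S u a b

  last-visit : ∀ {S a b} u → Walk S a b → LastVisit S u a b
  last-visit {S} {a = a} u (here s) with a ≟ u
  ... | yes a≡u = ends-at a≡u
  ... | no  a≢u = avoids (here (minusV-∋ {S = S} s a≢u))
  last-visit {S} {b = z} u (step w yz s) with z ≟ u
  ... | yes z≡u = ends-at z≡u
  ... | no  z≢u with last-visit u w
  ...   | avoids q      = avoids (step q yz (minusV-∋ {S = S} s z≢u))
  ...   | ends-at refl  = leaves yz (here (minusV-∋ {S = S} s z≢u))
  ...   | leaves uy q   = leaves uy (step q yz (minusV-∋ {S = S} s z≢u))

  forget-avoidˡ : ∀ {u v a b} → Walk (minusV (allBut u) v) a b → Walk (allBut v) a b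
  forget-avoidˡ {u} = walk-mono λ _ h → allBut-∋ (minusV-∌ {S = allBut u} h)

  forget-avoidʳ : ∀ {u v a b} → Walk (minusV (allBut u) v) a b → Walk (allBut u) a b
  forget-avoidʳ {u} = walk-mono λ _ → minusV-⊆ {S = allBut u}

  record Below (u x : Fin n) : Set where
    constructor mkBelow
    field
      distinct  : x ≢ u
      reached   : u ~ x
      separated : ¬ Walk (allBut u) x (root u)

  -- Opaque: unfolding these decision procedures during unification makes typechecking very slow.
  opaque
    below? : ∀ u x → Dec (Below u x)
    below? u x = map′ (λ (x≢u , u~x , sep) → mkBelow x≢u u~x sep)
                      (λ (mkBelow x≢u u~x sep) → x≢u , u~x , sep)
                      (¬? (x ≟ u) ×-dec walk? allV u x ×-dec ¬? (walk? (allBut u) x (root u)))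

  below : Fin n → Fin n → Bool
  below u x = ⌊ below? u x ⌋

  ¬below⇒joins-root : ∀ {u y} → ¬ Below u y → y ≢ u → u ~ y → Walk (allBut u) y (root u)
  ¬below⇒joins-root {u} {y} ¬below y≢u u~y with walk? (allBut u) y (root u)
  ... | yes w  = w
  ... | no  ¬w = contradiction (mkBelow y≢u u~y ¬w) ¬below

  below-closed : ∀ {w x y} → Below w x → T (adj G x y) → y ≢ w → Below w y
  below-closed (mkBelow x≢w w~x sep) xy y≢w =
    mkBelow y≢w (walk-trans w~x (edge xy _ _)) (λ q → sep (walk-cons xy (allBut-∋ x≢w) q))

  below-asym : ∀ {u v} → Below u v → ¬ Below v u
  below-asym {u} {v} (mkBelow v≢u u~v sepᵤ) (mkBelow u≢v _ sepᵥ)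
    with last-visit u (walk-sym (walk-trans (root~ u) u~v))
  ... | avoids q       = sepᵤ q
  ... | ends-at root≡u =
    sepᵥ (subst (Walk (allBut v) u) (trans (sym root≡u) (root-cong u~v)) (here (allBut-∋ u≢v)))
  ... | leaves uy q with last-visit v q
  ...   | avoids q′      = sepᵥ (subst (Walk (allBut v) u) (root-cong u~v)
                                   (walk-cons uy (allBut-∋ u≢v) (forget-avoidˡ q′)))
  ...   | ends-at root≡v = sepᵤ (subst (Walk (allBut u) v) (sym root≡v) (here (allBut-∋ v≢u)))
  ...   | leaves vz q′   = sepᵤ (walk-cons vz (allBut-∋ v≢u) (forget-avoidʳ q′))

  below-trans : ∀ {u v x} → Below u v → Below v x → Below u x
  below-trans {u} {v} {x} u▹v@(mkBelow v≢u u~v sepᵤ) v▹x@(mkBelow _ v~x sepᵥ) =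
    mkBelow x≢u (walk-trans u~v v~x) sep
    where
    x≢u : x ≢ u
    x≢u refl = below-asym u▹v v▹x
    sep : ¬ Walk (allBut u) x (root u)
    sep q with last-visit v q
    ... | avoids q′      = sepᵥ (subst (Walk (allBut v) x) (root-cong u~v) (forget-avoidˡ q′))
    ... | ends-at root≡v = sepᵤ (subst (Walk (allBut u) v) (sym root≡v) (here (allBut-∋ v≢u)))
    ... | leaves vy q′   = sepᵤ (walk-cons vy (allBut-∋ v≢u) (forget-avoidʳ q′))

  below-comparable : ∀ {v w x} → Below v x → Below w x → v ≢ w → Below v w ⊎ Below w v
  below-comparable {v} {w} {x} v▹x w▹x v≢w with below? v w | below? w v
  ... | yes v▹w | _       = inj₁ v▹w
  ... | no  _   | yes w▹v = inj₂ w▹v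
  ... | no ¬v▹w | no ¬w▹v = ⊥-elim absurd
    where
    open Below
    v~w : v ~ w
    v~w = walk-trans (reached v▹x) (walk-sym (reached w▹x))
    w⟶rootₓ : Walk (allBut v) w (root x)
    w⟶rootₓ = subst (Walk (allBut v) w) (root-cong (reached v▹x))
                (¬below⇒joins-root ¬v▹w (v≢w ∘ sym) v~w)
    v⟶rootₓ : Walk (allBut w) v (root x)
    v⟶rootₓ = subst (Walk (allBut w) v) (root-cong (reached w▹x))
                (¬below⇒joins-root ¬w▹v v≢w (walk-sym v~w))
    sepv : ¬ Walk (allBut v) x (root x)
    sepv q = separated v▹x (subst (Walk (allBut v) x) (sym (root-cong (reached v▹x))) q)
    sepw : ¬ Walk (allBut w) x (root x)
    sepw q = separated w▹x (subst (Walk (allBut w) x) (sym (root-cong (reached w▹x))) q)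
    absurd : ⊥
    absurd with last-visit v (root~ x)
    ... | avoids q    = sepv (walk-sym q)
    ... | ends-at x≡v = distinct v▹x x≡v
    ... | leaves vy q with last-visit w q
    ...   | avoids q′    = sepw (walk-trans (walk-sym (walk-cons vy (allBut-∋ v≢w) (forget-avoidˡ q′)))
                                            v⟶rootₓ)
    ...   | ends-at x≡w  = distinct w▹x x≡w
    ...   | leaves wz q′ = sepv (walk-trans (walk-sym (walk-cons wz (allBut-∋ (v≢w ∘ sym)) (forget-avoidʳ q′)))
                                            w⟶rootₓ)

  below-root : ∀ {u x} → root u ≡ u → x ≢ u → u ~ x → Below u x
  below-root {u} root≡u x≢u u~x = mkBelow x≢u u~x λ q →
    minusV-∌ {S = allV} (subst (T ∘ allBut u) root≡u (walk-target q)) refl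

  below-root-adj : ∀ {u x} → root u ≡ u → T (adj G u x) → Below u x
  below-root-adj root≡u ux = below-root root≡u (λ x≡u → adj⇒≢ ux (sym x≡u)) (edge ux _ _)

  cut-vertex-has-below : ∀ {u} → T (isCut G u) → ∃[ x ] Below u x
  cut-vertex-has-below {u} cut with any? (below? u)
  ... | yes found = found
  ... | no  none  = contradiction (count-mono {p = isRootOnᵇ (allBut u)} roots-of-G-u-are-roots)
                                  (<⇒≱ (<ᵇ⇒< _ _ cut))
    where
    -- Without vertices below u, deleting u splits no component.
    roots-of-G-u-are-roots : ∀ v → T (isRootOnᵇ (allBut u) v) → T (isRootᵇ v)
    roots-of-G-u-are-roots v h = Equivalence.from T-isRootᵇ
      (root-minimal λ root<v → isRootOnᵇ-least h root<v root⟶v)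
      where
      v≢u : v ≢ u
      v≢u = minusV-∌ {S = allV} (proj₁ (Equivalence.to (T-∧ {allBut u v}) h))
      root⟶v : Walk (allBut u) (root v) v
      root⟶v with walk? allV u v
      ... | yes u~v = subst (λ r → Walk (allBut u) r v) (root-cong u~v)
                        (walk-sym (¬below⇒joins-root (λ u▹v → none (v , u▹v)) v≢u u~v))
      ... | no ¬u~v with last-visit u (root~ v)
      ...   | avoids q    = q
      ...   | ends-at v≡u = contradiction v≡u v≢u
      ...   | leaves uy q = contradiction (walk-cons uy _ (walk-mono (λ _ _ → _) q)) ¬u~v

  IsCut : Fin n → Set
  IsCut w = T (isCut G w)

  Covered : Fin n → Fin n → Set
  Covered u x = ∃[ w ] IsCut w × Below u w × Below w x

  opaque
    covered? : ∀ u x → Dec (Covered u x)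
    covered? u x = any? λ w → T? (isCut G w) ×-dec below? u w ×-dec below? w x

  -- In block-cut-tree terms, the children of u are the cut vertices of the blocks
  -- hanging below u, and the loose vertices are the remaining vertices of those blocks.
  Child : Fin n → Fin n → Set
  Child u v = Below u v × IsCut v × ¬ Covered u v

  opaque
    child? : ∀ u v → Dec (Child u v)
    child? u v = below? u v ×-dec T? (isCut G v) ×-dec ¬? (covered? u v)

  Loose : Fin n → Fin n → Set
  Loose u x = Below u x × ¬ Child u x × ¬ Covered u x

  opaque
    loose? : ∀ u x → Dec (Loose u x)
    loose? u x = below? u x ×-dec ¬? (child? u x) ×-dec ¬? (covered? u x)

  covered child loose : Fin n → Fin n → Bool
  covered u x = ⌊ covered? u x ⌋
  child   u x = ⌊ child? u x ⌋
  loose   u x = ⌊ loose? u x ⌋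

  covered⇒below : ∀ {u x} → Covered u x → Below u x
  covered⇒below (_ , _ , u▹w , w▹x) = below-trans u▹w w▹x

  |below|-< : ∀ {u v} → Below u v → count (below v) < count (below u)
  |below|-< {u} {v} u▹v = count-< {p = below v} {below u} {v}
    (λ _ v▹y → fromWitness (below-trans u▹v (toWitness v▹y)))
    (fromWitness u▹v)
    (λ v▹v → Below.distinct (toWitness v▹v) refl)

  -- The separating cut vertex with the most vertices below it is a child.
  child-exists : ∀ {u x} → Covered u x → ∃[ v ] Child u v × Below v x
  child-exists {u} {x} (w , w-cut , u▹w , w▹x)
    with min-witness (λ w → T? (isCut G w) ×-dec below? u w ×-dec below? w x)
                     (λ w → n ∸ count (below w)) (w-cut , u▹w , w▹x)
  ... | v , (v-cut , u▹v , v▹x) , topmost = v , (u▹v , v-cut , uncovered) , v▹x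
    where
    uncovered : ¬ Covered u v
    uncovered (w′ , w′-cut , u▹w′ , w′▹v) =
      <⇒≱ (∸-monoʳ-< (|below|-< w′▹v) (count≤n (below w′)))
          (topmost w′ (w′-cut , u▹w′ , below-trans w′▹v v▹x))

  child-unique : ∀ {u x v v′} → Child u v → Below v x → Child u v′ → Below v′ x → v ≡ v′
  child-unique {v = v} {v′} (u▹v , v-cut , v-top) v▹x (u▹v′ , v′-cut , v′-top) v′▹x with v ≟ v′
  ... | yes v≡v′ = v≡v′
  ... | no  v≢v′ with below-comparable v▹x v′▹x v≢v′
  ...   | inj₁ v▹v′ = contradiction (v , v-cut , u▹v , v▹v′) v′-top
  ...   | inj₂ v′▹v = contradiction (v′ , v′-cut , u▹v′ , v′▹v) v-top

  children-above : ∀ u x → count (λ v → child u v ∧ below v x) ≡ 𝟙 (covered u x)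
  children-above u x with covered? u x
  ... | yes cov = ≤-antisym
    (count≤1 {p = λ v → child u v ∧ below v x} λ v v′ h h′ →
      let v-child , v▹x = Equivalence.to (T-∧ {child u v}) h
          v′-child , v′▹x = Equivalence.to (T-∧ {child u v′}) h′
      in child-unique (toWitness v-child) (toWitness v▹x) (toWitness v′-child) (toWitness v′▹x))
    (let v , v-child , v▹x = child-exists cov in
      count>0 {p = λ v → child u v ∧ below v x} {v}
        (Equivalence.from (T-∧ {child u v}) (fromWitness v-child , fromWitness v▹x)))
  ... | no ¬cov = count-none {p = λ v → child u v ∧ below v x} λ v h →
    let v-child , v▹x = Equivalence.to (T-∧ {child u v}) h
        u▹v , v-cut , _ = toWitness v-child
    in ¬cov (v , v-cut , u▹v , toWitness v▹x)

  ∑children : Fin n → (Fin n → ℕ) → ℕ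
  ∑children u f = ∑[ v < n ] (𝟙 (child u v) * f v)

  -- Every covered vertex lies below exactly one child.
  ∑children-count : ∀ u (q : Fin n → Bool) →
                    ∑children u (λ v → count (λ x → q x ∧ below v x)) ≡ count (λ x → q x ∧ covered u x)
  ∑children-count u q = begin
    ∑[ v < n ] (𝟙 (child u v) * count (λ x → q x ∧ below v x))
      ≡⟨ sum-cong-≗ (λ v → 𝟙*count (child u v) (λ x → q x ∧ below v x)) ⟩
    ∑[ v < n ] count (λ x → child u v ∧ (q x ∧ below v x))
      ≡⟨ ∑-count-comm (λ v x → child u v ∧ (q x ∧ below v x)) ⟩
    ∑[ x < n ] count (λ v → child u v ∧ (q x ∧ below v x))
      ≡⟨ sum-cong-≗ per-vertex ⟩
    ∑[ x < n ] 𝟙 (q x ∧ covered u x)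
      ≡⟨ count≡∑ (λ x → q x ∧ covered u x) ⟨
    count (λ x → q x ∧ covered u x)
      ∎
    where
    open ≡-Reasoning
    per-vertex : ∀ x → count (λ v → child u v ∧ (q x ∧ below v x)) ≡ 𝟙 (q x ∧ covered u x)
    per-vertex x = begin
      count (λ v → child u v ∧ (q x ∧ below v x))
        ≡⟨ count-cong (λ v → ∧-Props.x∙yz≈y∙xz (child u v) (q x) (below v x)) ⟩
      count (λ v → q x ∧ (child u v ∧ below v x))
        ≡⟨ 𝟙*count (q x) (λ v → child u v ∧ below v x) ⟨
      𝟙 (q x) * count (λ v → child u v ∧ below v x)
        ≡⟨ cong (𝟙 (q x) *_) (children-above u x) ⟩
      𝟙 (q x) * 𝟙 (covered u x)
        ≡⟨ 𝟙-∧ (q x) (covered u x) ⟨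
      𝟙 (q x ∧ covered u x)
        ∎

  ∑children-mono : ∀ {u f g} → (∀ v → Child u v → f v ≤ g v) → ∑children u f ≤ ∑children u g
  ∑children-mono {u} f≤g = ∑-mono-≤ λ v → 𝟙*-mono (child u v) (f≤g v ∘ toWitness)

  ∑children-+ : ∀ u f g → ∑children u (λ v → f v + g v) ≡ ∑children u f + ∑children u g
  ∑children-+ u f g = trans (sum-cong-≗ λ v → *-distribˡ-+ (𝟙 (child u v)) (f v) (g v))
                            (∑-distrib-+ (λ v → 𝟙 (child u v) * f v) (λ v → 𝟙 (child u v) * g v))

  ∑children-* : ∀ u k f → ∑children u (λ v → k * f v) ≡ k * ∑children u f
  ∑children-* u k f = trans (sum-cong-≗ λ v → *-Props.x∙yz≈y∙xz (𝟙 (child u v)) k (f v))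
                            (sym (*-distribˡ-sum k (λ v → 𝟙 (child u v) * f v)))

  ∑children-1 : ∀ u → ∑children u (λ _ → 1) ≡ count (child u)
  ∑children-1 u = trans (sum-cong-≗ λ v → *-identityʳ (𝟙 (child u v))) (sym (count≡∑ (child u)))

  child≤∑children : ∀ {u v} f → Child u v → f v ≤ ∑children u f
  child≤∑children {u} {v} f c = subst (_≤ ∑children u f) 𝟙*f≡f (term≤∑ (λ v → 𝟙 (child u v) * f v) v)
    where
    𝟙*f≡f : 𝟙 (child u v) * f v ≡ f v
    𝟙*f≡f = trans (cong (_* f v) (𝟙-true {child u v} (fromWitness c))) (*-identityˡ (f v))

  cutsBelow nbrsBelow : Fin n → ℕ
  cutsBelow u = count (λ x → isCut G x ∧ below u x)
  nbrsBelow u = count (λ x → adj G u x ∧ below u x)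

  adj⇒¬covered : ∀ {u x} → T (adj G u x) → ¬ Covered u x
  adj⇒¬covered ux (w , _ , u▹w , w▹x) =
    below-asym u▹w (below-closed w▹x (adj-sym ux) (Below.distinct u▹w ∘ sym))

  child-or-loose : ∀ {u x} → Below u x → ¬ Covered u x → Child u x ⊎ Loose u x
  child-or-loose {u} {x} u▹x ¬cov with child? u x
  ... | yes x-child = inj₁ x-child
  ... | no  ¬child  = inj₂ (u▹x , ¬child , ¬cov)

  below-partition : ∀ u → count (loose u) + count (child u) + count (covered u) ≤ count (below u)
  below-partition u = begin
    count (loose u) + count (child u) + count (covered u)
      ≡⟨ +-assoc (count (loose u)) _ _ ⟩
    count (loose u) + (count (child u) + count (covered u))
      ≡⟨ cong (count (loose u) +_) (count-∨-disjoint child∌covered) ⟨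
    count (loose u) + count (λ x → child u x ∨ covered u x)
      ≡⟨ count-∨-disjoint loose∌rest ⟨
    count (λ x → loose u x ∨ (child u x ∨ covered u x))
      ≤⟨ count-mono parts⊆below ⟩
    count (below u)
      ∎
    where
    open ≤-Reasoning
    child∌covered : ∀ x → T (child u x) → ¬ T (covered u x)
    child∌covered x c cov = proj₂ (proj₂ (toWitness c)) (toWitness cov)
    loose∌rest : ∀ x → T (loose u x) → ¬ T (child u x ∨ covered u x)
    loose∌rest x l h with toWitness l | Equivalence.to (T-∨ {child u x}) h
    ... | _ , ¬child , _    | inj₁ c   = ¬child (toWitness c)
    ... | _ , _      , ¬cov | inj₂ cov = ¬cov (toWitness cov)
    parts⊆below : ∀ x → T (loose u x ∨ (child u x ∨ covered u x)) → T (below u x)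
    parts⊆below x h with Equivalence.to (T-∨ {loose u x}) h
    ... | inj₁ l = fromWitness (proj₁ (toWitness l))
    ... | inj₂ h′ with Equivalence.to (T-∨ {child u x}) h′
    ...   | inj₁ c   = fromWitness (proj₁ (toWitness c))
    ...   | inj₂ cov = fromWitness (covered⇒below (toWitness cov))

  cutsBelow-split : ∀ u → cutsBelow u ≤ count (child u) + count (λ x → isCut G x ∧ covered u x)
  cutsBelow-split u = ≤-trans (count-mono {p = λ x → isCut G x ∧ below u x} split)
                              (count-∨ (child u) (λ x → isCut G x ∧ covered u x))
    where
    split : ∀ x → T (isCut G x ∧ below u x) → T (child u x ∨ (isCut G x ∧ covered u x))
    split x h with Equivalence.to (T-∧ {isCut G x}) h
    ... | x-cut , u▹x = Equivalence.from (T-∨ {child u x}) (by-coverage (covered? u x))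
      where
      by-coverage : Dec (Covered u x) → T (child u x) ⊎ T (isCut G x ∧ covered u x)
      by-coverage (yes cov) = inj₂ (Equivalence.from (T-∧ {isCut G x}) (x-cut , fromWitness cov))
      by-coverage (no ¬cov) = inj₁ (fromWitness (toWitness u▹x , x-cut , ¬cov))

  nbrsBelow-split : ∀ u → nbrsBelow u ≤ count (loose u) + count (child u)
  nbrsBelow-split u = ≤-trans (count-mono {p = λ x → adj G u x ∧ below u x} split) (count-∨ (loose u) (child u))
    where
    split : ∀ x → T (adj G u x ∧ below u x) → T (loose u x ∨ child u x)
    split x h with Equivalence.to (T-∧ {adj G u x}) h
    ... | ux , u▹x with child-or-loose (toWitness u▹x) (adj⇒¬covered ux)
    ...   | inj₁ c = Equivalence.from (T-∨ {loose u x}) (inj₂ (fromWitness c))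
    ...   | inj₂ l = Equivalence.from (T-∨ {loose u x}) (inj₁ (fromWitness l))

  Around : Fin n → Fin n → Set
  Around u y = y ≡ u ⊎ Loose u y ⊎ Child u y

  around : Fin n → Fin n → Bool
  around u y = ⌊ y ≟ u ⌋ ∨ loose u y ∨ child u y

  around-∋ : ∀ {u y} → Around u y → T (around u y)
  around-∋ {u} {y} (inj₁ y≡u)       = Equivalence.from (T-∨ {⌊ y ≟ u ⌋}) (inj₁ (fromWitness y≡u))
  around-∋ {u} {y} (inj₂ (inj₁ l)) = Equivalence.from (T-∨ {⌊ y ≟ u ⌋})
                                       (inj₂ (Equivalence.from (T-∨ {loose u y}) (inj₁ (fromWitness l))))
  around-∋ {u} {y} (inj₂ (inj₂ c)) = Equivalence.from (T-∨ {⌊ y ≟ u ⌋})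
                                       (inj₂ (Equivalence.from (T-∨ {loose u y}) (inj₂ (fromWitness c))))

  count-around : ∀ u → count (around u) ≤ suc (count (loose u) + count (child u))
  count-around u = begin
    count (around u)
      ≤⟨ count-∨ (λ y → ⌊ y ≟ u ⌋) (λ y → loose u y ∨ child u y) ⟩
    count (λ y → ⌊ y ≟ u ⌋) + count (λ y → loose u y ∨ child u y)
      ≤⟨ +-mono-≤ (≤-reflexive (count-singleton u)) (count-∨ (loose u) (child u)) ⟩
    suc (count (loose u) + count (child u))
      ∎
    where open ≤-Reasoning

  neighbour-of-uncovered : ∀ {u w y} → Below u w → ¬ Covered u w → T (adj G w y) →
                           Around u y ⊎ (IsCut w × Below w y)
  neighbour-of-uncovered {u} {w} {y} u▹w ¬cov-w wy with y ≟ u | covered? u y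
  ... | yes y≡u | _       = inj₁ (inj₁ y≡u)
  ... | no  y≢u | no ¬cov = inj₁ (inj₂ ([ inj₂ , inj₁ ]′ (child-or-loose (below-closed u▹w wy y≢u) ¬cov)))
  ... | no  _   | yes (w′ , w′-cut , u▹w′ , w′▹y) with w′ ≟ w
  ...   | yes refl = inj₂ (w′-cut , w′▹y)
  ...   | no  w′≢w =
    contradiction (w′ , w′-cut , u▹w′ , below-closed w′▹y (adj-sym wy) (w′≢w ∘ sym)) ¬cov-w

  inComponent : Fin n → Fin n → Bool
  inComponent r x = ⌊ r ≟ root x ⌋

  inComponent⇒root : ∀ {r x} → T (inComponent r x) → root r ≡ r
  inComponent⇒root {r} {x} h = let r≡rootₓ = toWitness h in
    trans (cong root r≡rootₓ) (trans (root-cong (root~ x)) (sym r≡rootₓ))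

  component-size : ∀ {r} → root r ≡ r → suc (count (below r)) ≤ count (inComponent r)
  component-size {r} root≡r = begin
    suc (count (below r))
      ≡⟨ cong (_+ count (below r)) (count-singleton r) ⟨
    count (λ x → ⌊ x ≟ r ⌋) + count (below r)
      ≡⟨ count-∨-disjoint {p = λ x → ⌊ x ≟ r ⌋} {below r} r∉below ⟨
    count (λ x → ⌊ x ≟ r ⌋ ∨ below r x)
      ≤⟨ count-mono {p = λ x → ⌊ x ≟ r ⌋ ∨ below r x} in-component ⟩
    count (inComponent r)
      ∎
    where
    open ≤-Reasoning
    r∉below : ∀ x → T ⌊ x ≟ r ⌋ → ¬ T (below r x)
    r∉below x x≡r r▹x = Below.distinct (toWitness r▹x) (toWitness x≡r)
    in-component : ∀ x → T (⌊ x ≟ r ⌋ ∨ below r x) → T (inComponent r x)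
    in-component x h with Equivalence.to (T-∨ {⌊ x ≟ r ⌋}) h
    ... | inj₁ x≡r = fromWitness (trans (sym root≡r) (cong root (sym (toWitness x≡r))))
    ... | inj₂ r▹x = fromWitness (trans (sym root≡r) (root-cong (Below.reached (toWitness r▹x))))

  cuts-in-component : ∀ {r} → root r ≡ r → count (λ x → isCut G x ∧ inComponent r x) ≤ 1 + cutsBelow r
  cuts-in-component {r} root≡r = begin
    count (λ x → isCut G x ∧ inComponent r x)
      ≤⟨ count-mono {p = λ x → isCut G x ∧ inComponent r x} r-or-below ⟩
    count (λ x → ⌊ x ≟ r ⌋ ∨ (isCut G x ∧ below r x))
      ≤⟨ count-∨ (λ x → ⌊ x ≟ r ⌋) (λ x → isCut G x ∧ below r x) ⟩
    count (λ x → ⌊ x ≟ r ⌋) + cutsBelow r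
      ≡⟨ cong (_+ cutsBelow r) (count-singleton r) ⟩
    1 + cutsBelow r
      ∎
    where
    open ≤-Reasoning
    r-or-below : ∀ x → T (isCut G x ∧ inComponent r x) → T (⌊ x ≟ r ⌋ ∨ (isCut G x ∧ below r x))
    r-or-below x h with Equivalence.to (T-∧ {isCut G x}) h
    ... | x-cut , r≡rootₓ = Equivalence.from (T-∨ {⌊ x ≟ r ⌋}) (by-x (x ≟ r))
      where
      by-x : Dec (x ≡ r) → T ⌊ x ≟ r ⌋ ⊎ T (isCut G x ∧ below r x)
      by-x (yes x≡r) = inj₁ (fromWitness x≡r)
      by-x (no  x≢r) = inj₂ (Equivalence.from (T-∧ {isCut G x}) (x-cut , fromWitness
        (below-root root≡r x≢r (subst (_~ x) (sym (toWitness r≡rootₓ)) (root~ x)))))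

  degree≤nbrsBelow : ∀ {r} → root r ≡ r → degree G r ≤ nbrsBelow r
  degree≤nbrsBelow {r} root≡r = count-mono {p = adj G r} {λ x → adj G r x ∧ below r x} λ x rx →
    Equivalence.from (T-∧ {adj G r x}) (rx , fromWitness (below-root-adj root≡r rx))

  module _ {δ : ℕ} (δ≤degree : ∀ v → δ ≤ degree G v) where

    δ<closed-neighbourhood : ∀ {w} {q : Fin n → Bool} → (∀ y → T (adj G w y) → T (q y)) → T (q w) →
                             δ < count q
    δ<closed-neighbourhood {w} {q} nbrs⊆q qw =
      ≤-<-trans (δ≤degree w) (count-< {p = adj G w} {q} {w} nbrs⊆q qw λ ww → adj⇒≢ ww refl)

    loose-degree : ∀ {u w} → Loose u w → δ ≤ count (loose u) + count (child u)
    loose-degree {u} {w} w-loose@(u▹w , ¬child , ¬cov) = ≤-pred (≤-trans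
      (δ<closed-neighbourhood {q = around u} nbrs⊆around (around-∋ (inj₂ (inj₁ w-loose))))
      (count-around u))
      where
      nbrs⊆around : ∀ y → T (adj G w y) → T (around u y)
      nbrs⊆around y wy = around-∋ ([ id , (λ (w-cut , _) → contradiction (u▹w , w-cut , ¬cov) ¬child) ]′
                                         (neighbour-of-uncovered u▹w ¬cov wy))

    child-degree : ∀ {u v} → Child u v → δ ≤ nbrsBelow v + (count (loose u) + count (child u))
    child-degree {u} {v} v-child@(u▹v , _ , ¬cov) = ≤-pred (begin-strict
      δ                                                         <⟨ δ<closed-neighbourhood {q = q} nbrs⊆q v∈q ⟩
      count q                                                   ≤⟨ count-∨ (λ y → adj G v y ∧ below v y) (around u) ⟩
      nbrsBelow v + count (around u)                            ≤⟨ +-monoʳ-≤ (nbrsBelow v) (count-around u) ⟩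
      nbrsBelow v + suc (count (loose u) + count (child u))     ≡⟨ +-suc (nbrsBelow v) _ ⟩
      suc (nbrsBelow v + (count (loose u) + count (child u)))   ∎)
      where
      open ≤-Reasoning
      q : Fin n → Bool
      q y = (adj G v y ∧ below v y) ∨ around u y
      nbrs⊆q : ∀ y → T (adj G v y) → T (q y)
      nbrs⊆q y vy = Equivalence.from (T-∨ {adj G v y ∧ below v y})
        ([ inj₂ ∘ around-∋ , (λ (_ , v▹y) → inj₁ (Equivalence.from (T-∧ {adj G v y}) (vy , fromWitness v▹y))) ]′
           (neighbour-of-uncovered u▹v ¬cov vy))
      v∈q : T (q v)
      v∈q = Equivalence.from (T-∨ {adj G v v ∧ below v v}) (inj₂ (around-∋ (inj₂ (inj₂ v-child))))

    δ≤loose+children+∑nbrs : ∀ {u} → (∃[ x ] Below u x) →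
                              δ ≤ count (loose u) + count (child u) + ∑children u nbrsBelow
    δ≤loose+children+∑nbrs {u} (x , u▹x) = by-cases (covered? u x)
      where
      L+t : ℕ
      L+t = count (loose u) + count (child u)
      via-child : ∀ {v} → Child u v → δ ≤ L+t + ∑children u nbrsBelow
      via-child {v} c = begin
        δ                                ≤⟨ child-degree c ⟩
        nbrsBelow v + L+t                ≤⟨ +-monoˡ-≤ L+t (child≤∑children nbrsBelow c) ⟩
        ∑children u nbrsBelow + L+t      ≡⟨ +-comm _ L+t ⟩
        L+t + ∑children u nbrsBelow      ∎
        where open ≤-Reasoning
      by-cases : Dec (Covered u x) → δ ≤ L+t + ∑children u nbrsBelow
      by-cases (yes cov) = via-child (proj₁ (proj₂ (child-exists cov)))
      by-cases (no ¬cov) =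
        [ via-child , (λ l → ≤-trans (loose-degree l) (m≤m+n L+t _)) ]′ (child-or-loose u▹x ¬cov)

    -- The conclusion is δ · (first) + second + third + fourth + 2 · (fifth hypothesis).
    below-bound-arith : ∀ {C A L t ΣC ΣA ΣD D} → C ≤ t + ΣC → A ≤ L + t → δ ≤ L + t + ΣA →
                        δ * (t + ΣC) + ΣA ≤ 2 * ΣD → L + t + ΣD ≤ D → δ * (1 + C) + A ≤ 2 * D
    below-bound-arith {C} {A} {L} {t} {ΣC} {ΣA} {ΣD} {D} C≤ A≤ δ≤ children≤ parts≤ = begin
      δ * (1 + C) + A                                  ≤⟨ +-mono-≤ (*-monoʳ-≤ δ (s≤s C≤)) A≤ ⟩
      δ * (1 + (t + ΣC)) + (L + t)                     ≡⟨ expand δ (t + ΣC) (L + t) ⟩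
      δ + δ * (t + ΣC) + (L + t)                       ≤⟨ +-monoˡ-≤ (L + t) (+-monoˡ-≤ (δ * (t + ΣC)) δ≤) ⟩
      L + t + ΣA + δ * (t + ΣC) + (L + t)              ≡⟨ regroup (L + t) ΣA (δ * (t + ΣC)) ⟩
      2 * (L + t) + (δ * (t + ΣC) + ΣA)                ≤⟨ +-monoʳ-≤ (2 * (L + t)) children≤ ⟩
      2 * (L + t) + 2 * ΣD                             ≡⟨ *-distribˡ-+ 2 (L + t) ΣD ⟨
      2 * (L + t + ΣD)                                 ≤⟨ *-monoʳ-≤ 2 parts≤ ⟩
      2 * D                                            ∎
      where
      open ≤-Reasoning
      expand : ∀ d x y → d * (1 + x) + y ≡ d + d * x + y
      expand = solve 3 (λ d x y → d :* (con 1 :+ x) :+ y := d :+ d :* x :+ y) refl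
      regroup : ∀ m a p → m + a + p + m ≡ 2 * m + (p + a)
      regroup = solve 3 (λ m a p → m :+ a :+ p :+ m := con 2 :* m :+ (p :+ a)) refl

    _⊏_ : Fin n → Fin n → Set
    v ⊏ u = count (below v) < count (below u)

    ⊏-wellFounded : WellFounded _⊏_
    ⊏-wellFounded = On.wellFounded (λ u → count (below u)) <-wellFounded

    below-bound : ∀ u → Acc _⊏_ u → (∃[ x ] Below u x) →
                  δ * (1 + cutsBelow u) + nbrsBelow u ≤ 2 * count (below u)
    below-bound u (acc rec) nonempty =
      below-bound-arith {cutsBelow u} {nbrsBelow u} {count (loose u)} {count (child u)}
                        {∑children u cutsBelow} {∑children u nbrsBelow} {∑children u (λ v → count (below v))}
                        cuts (nbrsBelow-split u) (δ≤loose+children+∑nbrs nonempty) children-bound parts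
      where
      cuts : cutsBelow u ≤ count (child u) + ∑children u cutsBelow
      cuts = subst (λ k → cutsBelow u ≤ count (child u) + k)
                   (sym (∑children-count u (isCut G))) (cutsBelow-split u)
      parts : count (loose u) + count (child u) + ∑children u (λ v → count (below v)) ≤ count (below u)
      parts = subst (λ k → count (loose u) + count (child u) + k ≤ count (below u))
                    (sym (∑children-count u (λ _ → true))) (below-partition u)
      ih : ∀ v → Child u v → δ * (1 + cutsBelow v) + nbrsBelow v ≤ 2 * count (below v)
      ih v (u▹v , v-cut , _) = below-bound v (rec {v} (|below|-< u▹v)) (cut-vertex-has-below v-cut)
      linear : ∑children u (λ v → δ * (1 + cutsBelow v) + nbrsBelow v) ≡
               δ * (count (child u) + ∑children u cutsBelow) + ∑children u nbrsBelow
      linear = begin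
        ∑children u (λ v → δ * (1 + cutsBelow v) + nbrsBelow v)
          ≡⟨ ∑children-+ u (λ v → δ * (1 + cutsBelow v)) nbrsBelow ⟩
        ∑children u (λ v → δ * (1 + cutsBelow v)) + ∑children u nbrsBelow
          ≡⟨ cong (_+ ∑children u nbrsBelow) (∑children-* u δ (λ v → 1 + cutsBelow v)) ⟩
        δ * ∑children u (λ v → 1 + cutsBelow v) + ∑children u nbrsBelow
          ≡⟨ cong (λ k → δ * k + ∑children u nbrsBelow)
                  (trans (∑children-+ u (λ _ → 1) cutsBelow) (cong (_+ ∑children u cutsBelow) (∑children-1 u))) ⟩
        δ * (count (child u) + ∑children u cutsBelow) + ∑children u nbrsBelow ∎
        where open ≡-Reasoning
      children-bound : δ * (count (child u) + ∑children u cutsBelow) + ∑children u nbrsBelow ≤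
                       2 * ∑children u (λ v → count (below v))
      children-bound = begin
        δ * (count (child u) + ∑children u cutsBelow) + ∑children u nbrsBelow
          ≡⟨ linear ⟨
        ∑children u (λ v → δ * (1 + cutsBelow v) + nbrsBelow v)
          ≤⟨ ∑children-mono ih ⟩
        ∑children u (λ v → 2 * count (below v))
          ≡⟨ ∑children-* u 2 (λ v → count (below v)) ⟩
        2 * ∑children u (λ v → count (below v))
          ∎
        where open ≤-Reasoning

    component-bound : 0 < δ → ∀ r →
      δ * (count (λ x → isCut G x ∧ inComponent r x) + 𝟙 (isRootᵇ r)) ≤ 2 * count (inComponent r)
    component-bound 0<δ r = by-cases (r ≟ root r)
      where
      cutsIn : ℕ
      cutsIn = count (λ x → isCut G x ∧ inComponent r x)
      by-cases : Dec (r ≡ root r) → δ * (cutsIn + 𝟙 (isRootᵇ r)) ≤ 2 * count (inComponent r)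
      by-cases (no r≢root) =
        ≤-trans (≤-reflexive (trans (cong (δ *_) (cong₂ _+_ no-cuts not-root)) (*-zeroʳ δ))) z≤n
        where
        no-cuts : cutsIn ≡ 0
        no-cuts = count-none {p = λ x → isCut G x ∧ inComponent r x} λ x h →
          r≢root (sym (inComponent⇒root (proj₂ (Equivalence.to (T-∧ {isCut G x}) h))))
        not-root : 𝟙 (isRootᵇ r) ≡ 0
        not-root = 𝟙-false λ h → r≢root (sym (Equivalence.to T-isRootᵇ h))
      by-cases (yes r≡root) = begin
        δ * (cutsIn + 𝟙 (isRootᵇ r))          ≡⟨ cong (λ k → δ * (cutsIn + k)) r-is-root ⟩
        δ * (cutsIn + 1)                      ≤⟨ *-monoʳ-≤ δ (+-monoˡ-≤ 1 (cuts-in-component root≡r)) ⟩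
        δ * (1 + cutsBelow r + 1)             ≡⟨ *-distribˡ-+ δ (1 + cutsBelow r) 1 ⟩
        δ * (1 + cutsBelow r) + δ * 1         ≡⟨ cong (δ * (1 + cutsBelow r) +_) (*-identityʳ δ) ⟩
        δ * (1 + cutsBelow r) + δ             ≤⟨ +-monoʳ-≤ (δ * (1 + cutsBelow r)) δ≤nbrs ⟩
        δ * (1 + cutsBelow r) + nbrsBelow r   ≤⟨ below-bound r (⊏-wellFounded r) nonempty ⟩
        2 * count (below r)                   ≤⟨ *-monoʳ-≤ 2 (n≤1+n _) ⟩
        2 * suc (count (below r))             ≤⟨ *-monoʳ-≤ 2 (component-size root≡r) ⟩
        2 * count (inComponent r)             ∎
        where
        open ≤-Reasoning
        root≡r : root r ≡ r
        root≡r = sym r≡root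
        r-is-root : 𝟙 (isRootᵇ r) ≡ 1
        r-is-root = 𝟙-true (Equivalence.from T-isRootᵇ root≡r)
        δ≤nbrs : δ ≤ nbrsBelow r
        δ≤nbrs = ≤-trans (δ≤degree r) (degree≤nbrsBelow root≡r)
        nonempty : ∃[ x ] Below r x
        nonempty = let x , rx = count>0⇒∃ {p = adj G r} (≤-trans 0<δ (δ≤degree r)) in
                   x , below-root-adj root≡r rx

cut-compo-bound : ∀ {n} (G : Graph n) {δ} → (∀ v → δ ≤ degree G v) → δ * (cut G + compo G) ≤ 2 * n
cut-compo-bound     G {zero}  _        = z≤n
cut-compo-bound {n} G {suc d} δ≤degree = begin
  δ * (cut G + compo G)
    ≡⟨ cong (δ *_) (cong₂ _+_ cut≡ (count≡∑ (isRootᵇ G))) ⟩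
  δ * (∑[ r < n ] cutsIn r + ∑[ r < n ] 𝟙 (isRootᵇ G r))
    ≡⟨ cong (δ *_) (∑-distrib-+ cutsIn (𝟙 ∘ isRootᵇ G)) ⟨
  δ * ∑[ r < n ] (cutsIn r + 𝟙 (isRootᵇ G r))
    ≡⟨ *-distribˡ-sum δ (λ r → cutsIn r + 𝟙 (isRootᵇ G r)) ⟩
  ∑[ r < n ] (δ * (cutsIn r + 𝟙 (isRootᵇ G r)))
    ≤⟨ ∑-mono-≤ (component-bound G δ≤degree (s≤s z≤n)) ⟩
  ∑[ r < n ] (2 * count (inComponent G r))
    ≡⟨ *-distribˡ-sum 2 (λ r → count (inComponent G r)) ⟨
  2 * ∑[ r < n ] count (inComponent G r)
    ≡⟨ cong (2 *_) vertices≡ ⟩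
  2 * n
    ∎
  where
  open ≤-Reasoning
  δ : ℕ
  δ = suc d
  cutsIn : Fin n → ℕ
  cutsIn r = count (λ x → isCut G x ∧ inComponent G r x)
  counted-once : ∀ x → 𝟙 (isCut G x) ≡ count (λ r → isCut G x ∧ inComponent G r x)
  counted-once x = begin-equality
    𝟙 (isCut G x)                                   ≡⟨ *-identityʳ _ ⟨
    𝟙 (isCut G x) * 1                               ≡⟨ cong (𝟙 (isCut G x) *_) (count-singleton (root G x)) ⟨
    𝟙 (isCut G x) * count (λ r → ⌊ r ≟ root G x ⌋)   ≡⟨ 𝟙*count (isCut G x) (λ r → ⌊ r ≟ root G x ⌋) ⟩
    count (λ r → isCut G x ∧ inComponent G r x)      ∎
  cut≡ : cut G ≡ ∑[ r < n ] cutsIn r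
  cut≡ = begin-equality
    count (isCut G)
      ≡⟨ count≡∑ (isCut G) ⟩
    ∑[ x < n ] 𝟙 (isCut G x)
      ≡⟨ sum-cong-≗ counted-once ⟩
    ∑[ x < n ] count (λ r → isCut G x ∧ inComponent G r x)
      ≡⟨ ∑-count-comm (λ r x → isCut G x ∧ inComponent G r x) ⟨
    ∑[ r < n ] cutsIn r
      ∎
  vertices≡ : ∑[ r < n ] count (inComponent G r) ≡ n
  vertices≡ = begin-equality
    ∑[ r < n ] count (inComponent G r)          ≡⟨ ∑-count-comm (inComponent G) ⟩
    ∑[ x < n ] count (λ r → ⌊ r ≟ root G x ⌋)    ≡⟨ sum-cong-≗ (λ x → count-singleton (root G x)) ⟩
    ∑[ x < n ] 1                                ≡⟨ count≡∑ {n} (λ _ → true) ⟨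
    count {n} (λ _ → true)                      ≡⟨ count-true {n} ⟩
    n                                           ∎

square-bound : ∀ {N d X} .{{_ : NonZero N}} → 4 * N ≤ d * d → d * X ≤ 2 * N → X * X ≤ N
square-bound {N} {d} {X} 4N≤d² dX≤2N = *-cancelˡ-≤ (4 * N) {{m*n≢0 4 N}} (begin
  4 * N * (X * X)     ≤⟨ *-monoˡ-≤ (X * X) 4N≤d² ⟩
  d * d * (X * X)     ≡⟨ [m*n]*[o*p]≡[m*o]*[n*p] d d X X ⟩
  (d * X) * (d * X)   ≤⟨ *-mono-≤ dX≤2N dX≤2N ⟩
  2 * N * (2 * N)     ≡⟨ doubled N ⟩
  4 * N * N           ∎)
  where
  open ≤-Reasoning
  doubled : ∀ n → 2 * n * (2 * n) ≡ 4 * n * n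
  doubled = solve 1 (λ n → con 2 :* n :* (con 2 :* n) := con 4 :* n :* n) refl

lemma2p1 : (n : ℕ) (G : Graph n) →
    ((v : Fin n) → 4 * n ≤ degree G v * degree G v) →
    (cut G + compo G ∸ 1) * (cut G + compo G ∸ 1) ≤ 4 * n
lemma2p1 zero    G _          = z≤n
lemma2p1 (suc m) G 4n≤degree² = begin
  (X ∸ 1) * (X ∸ 1)   ≤⟨ *-mono-≤ (m∸n≤m X 1) (m∸n≤m X 1) ⟩
  X * X               ≤⟨ square-bound {d = degree G v₀} {X} (4n≤degree² v₀) (cut-compo-bound G minimal) ⟩
  suc m               ≤⟨ m≤n*m (suc m) 4 ⟩
  4 * suc m           ∎
  where
  open ≤-Reasoning
  X : ℕ
  X = cut G + compo G
  min-degree : ∃[ v ] ⊤ × (∀ w → ⊤ → degree G v ≤ degree G w)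
  min-degree = min-witness (λ _ → yes tt) (degree G) {zero} tt
  v₀ : Fin (suc m)
  v₀ = proj₁ min-degree
  minimal : ∀ w → degree G v₀ ≤ degree G w
  minimal w = proj₂ (proj₂ min-degree) w tt
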